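{- Let $\mathbb{C}_1,\dots,\mathbb{C}_n$ and $\mathbb{D}$ be comonads on categories $\mathcal{C}_1,\dots,\mathcal{C}_n$ and $\mathcal{D}$, each base category carrying a proper factorisation system and each comonad preserving embeddings, let $H\colon\prod_i\mathcal{C}_i\to\mathcal{D}$ be a functor, $\kappa\colon\mathbb{D}\circ H\Rightarrow H\circ\prod_i\mathbb{C}_i$ a Kleisli law, and assume $\mathrm{EM}(\mathbb{D})$ has equalisers, and let $\widehat H\colon\prod_i\mathrm{EM}(\mathbb{C}_i)\to\mathrm{EM}(\mathbb{D})$ be the functor defined below. If $H$ preserves embeddings (i.e. $H(e_1,\dots,e_n)$ is an embedding whenever each $e_i$ is), then so does $\widehat H$ (with respect to the lifted factorisation systems on the coalgebra categories).
   Context: A proper factorisation system $(\mathcal{E},\mathcal{M})$ on a category: every morphism factors as $m\circ e$, $e\in\mathcal{E}$, $m\in\mathcal{M}$; $\mathcal{E}$ and $\mathcal{M}$ are each other's weak-orthogonality classes (diagonal fillers for commuting squares); $\mathcal{E}$ consists of epis and $\mathcal{M}$ of monos. Members of $\mathcal{M}$ are embeddings. A comonad $\mathbb{C}$ preserves embeddings if $\mathbb{C}(m)$ is an embedding whenever $m$ is. For such a comonad, $\mathrm{EM}(\mathbb{C})$ (coalgebras $(A,\alpha)$ with $\varepsilon_A\circ\alpha=\mathrm{id}$, $\delta_A\circ\alpha=\mathbb{C}(\alpha)\circ\alpha$, and coalgebra morphisms) carries the lifted proper factorisation system: a coalgebra morphism is an embedding (resp. quotient) iff its underlying morphism is. $F^{\mathbb{C}}(A)=(\mathbb{C}A,\delta_A)$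 is the cofree coalgebra. A Kleisli law is a natural $\kappa$ with components $\kappa_{\vec A}\colon\mathbb{D}H(\vec A)\to H(\mathbb{C}_1A_1,\dots,\mathbb{C}_nA_n)$ satisfying $H(\varepsilon_{A_1},\dots)\circ\kappa=\varepsilon_H$ and $H(\delta_{A_1},\dots)\circ\kappa=\kappa_{\mathbb{C}\vec A}\circ\mathbb{D}(\kappa)\circ\delta_H$. On objects, $\widehat H(\vec\alpha)$ is the domain of the equaliser $\iota_{\vec\alpha}\colon\widehat H(\vec\alpha)\to F^{\mathbb{D}}(H(\vec A))$ in $\mathrm{EM}(\mathbb{D})$ of $\mathbb{D}(\kappa_{\vec A})\circ\delta_{H(\vec A)}$ and $\mathbb{D}(H(\alpha_1,\dots,\alpha_n))$; on coalgebra morphisms $f_i\colon(A_i,\alpha_i)\to(B_i,\beta_i)$, $\widehat H(\vec f)$ is the unique morphism with $\iota_{\vec\beta}\circ\widehat H(\vec f)=\mathbb{D}(H(\vec f))\circ\iota_{\vec\alpha}$. -}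

module Defs where

open import Level using (Level; _⊔_) renaming (suc to lsuc)
open import Data.Nat using (ℕ)
open import Data.Fin using (Fin)
open import Data.Product using (Σ; _×_; _,_; proj₁; proj₂; ∃-syntax)
open import Function.Bundles using (_⇔_)
open import Relation.Binary using (Rel; IsEquivalence; Setoid)
import Relation.Binary.Reasoning.Setoid as SetoidR

record Category (o ℓ e : Level) : Set (lsuc (o ⊔ ℓ ⊔ e)) where
  infix  4 _≈_
  infixr 9 _∘_
  field
    Obj       : Set o
    Hom       : Obj → Obj → Set ℓ
    _≈_       : ∀ {A B} → Rel (Hom A B) e
    id        : ∀ {A} → Hom A A
    _∘_       : ∀ {A B C} → Hom B C → Hom A B → Hom A C
    equiv     : ∀ {A B} → IsEquivalence (_≈_ {A} {B})
    ∘-resp-≈  : ∀ {A B C} {f h : Hom B C} {g i : Hom A B} →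
                f ≈ h → g ≈ i → f ∘ g ≈ h ∘ i
    identityˡ : ∀ {A B} {f : Hom A B} → id ∘ f ≈ f
    identityʳ : ∀ {A B} {f : Hom A B} → f ∘ id ≈ f
    assoc     : ∀ {A B C D} {f : Hom A B} {g : Hom B C} {h : Hom C D} →
                (h ∘ g) ∘ f ≈ h ∘ (g ∘ f)

  hom-setoid : Obj → Obj → Setoid ℓ e
  hom-setoid A B = record { Carrier = Hom A B ; _≈_ = _≈_ ; isEquivalence = equiv }

  module Eq {A B : Obj} = IsEquivalence (equiv {A} {B})

  Mono : ∀ {A B} → Hom A B → Set (o ⊔ ℓ ⊔ e)
  Mono {A} f = ∀ {X} (g h : Hom X A) → f ∘ g ≈ f ∘ h → g ≈ h

  Epi : ∀ {A B} → Hom A B → Set (o ⊔ ℓ ⊔ e)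
  Epi {B = B} f = ∀ {X} (g h : Hom B X) → g ∘ f ≈ h ∘ f → g ≈ h

  _⧄_ : ∀ {A B X Y} → Hom A B → Hom X Y → Set (ℓ ⊔ e)
  _⧄_ {A} {B} {X} {Y} f m =
    (u : Hom A X) (v : Hom B Y) → v ∘ f ≈ m ∘ u →
    ∃[ d ] ((d ∘ f ≈ u) × (m ∘ d ≈ v))

record Functor {o ℓ e o′ ℓ′ e′ : Level}
               (C : Category o ℓ e) (D : Category o′ ℓ′ e′)
               : Set (o ⊔ ℓ ⊔ e ⊔ o′ ⊔ ℓ′ ⊔ e′) where
  private
    module C = Category C
    module D = Category D
  field
    F₀           : C.Obj → D.Obj
    F₁           : ∀ {A B} → C.Hom A B → D.Hom (F₀ A) (F₀ B)
    identity     : ∀ {A} → F₁ (C.id {A}) D.≈ D.id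
    homomorphism : ∀ {X Y Z} {f : C.Hom X Y} {g : C.Hom Y Z} →
                   F₁ (g C.∘ f) D.≈ F₁ g D.∘ F₁ f
    F-resp-≈     : ∀ {A B} {f g : C.Hom A B} → f C.≈ g → F₁ f D.≈ F₁ g

Π : ∀ {o ℓ e} (n : ℕ) → (Fin n → Category o ℓ e) → Category o ℓ e
Π n Cs = record
  { Obj       = (i : Fin n) → Category.Obj (Cs i)
  ; Hom       = λ A B → (i : Fin n) → Category.Hom (Cs i) (A i) (B i)
  ; _≈_       = λ f g → (i : Fin n) → Category._≈_ (Cs i) (f i) (g i)
  ; id        = λ i → Category.id (Cs i)
  ; _∘_       = λ f g i → Category._∘_ (Cs i) (f i) (g i)
  ; equiv     = record
      { refl  = λ i → Category.Eq.refl (Cs i)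
      ; sym   = λ p i → Category.Eq.sym (Cs i) (p i)
      ; trans = λ p q i → Category.Eq.trans (Cs i) (p i) (q i) }
  ; ∘-resp-≈  = λ p q i → Category.∘-resp-≈ (Cs i) (p i) (q i)
  ; identityˡ = λ i → Category.identityˡ (Cs i)
  ; identityʳ = λ i → Category.identityʳ (Cs i)
  ; assoc     = λ i → Category.assoc (Cs i)
  }

record Comonad {o ℓ e : Level} (C : Category o ℓ e) : Set (o ⊔ ℓ ⊔ e) where
  open Category C
  field
    F : Functor C C
  open Functor F public
  field
    ε          : ∀ X → Hom (F₀ X) X
    δ          : ∀ X → Hom (F₀ X) (F₀ (F₀ X))
    ε-natural  : ∀ {X Y} (f : Hom X Y) → ε Y ∘ F₁ f ≈ f ∘ ε X
    δ-natural  : ∀ {X Y} (f : Hom X Y) → δ Y ∘ F₁ f ≈ F₁ (F₁ f) ∘ δ X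
    unitˡ      : ∀ X → F₁ (ε X) ∘ δ X ≈ id
    unitʳ      : ∀ X → ε (F₀ X) ∘ δ X ≈ id
    coassoc    : ∀ X → F₁ (δ X) ∘ δ X ≈ δ (F₀ X) ∘ δ X

record ProperFactorisationSystem {o ℓ e : Level} (C : Category o ℓ e) (p : Level)
       : Set (o ⊔ ℓ ⊔ e ⊔ lsuc p) where
  open Category C
  field
    E : ∀ {A B} → Hom A B → Set p
    M : ∀ {A B} → Hom A B → Set p
    factorise : ∀ {A B} (f : Hom A B) →
                Σ Obj λ I → Σ (Hom A I) λ q → Σ (Hom I B) λ m →
                E q × M m × (m ∘ q ≈ f)
    E-is-⧄M : ∀ {A B} (f : Hom A B) →
              E f ⇔ (∀ {X Y} (m : Hom X Y) → M m → f ⧄ m)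
    M-is-E⧄ : ∀ {X Y} (m : Hom X Y) →
              M m ⇔ (∀ {A B} (f : Hom A B) → E f → f ⧄ m)
    E⊆Epi  : ∀ {A B} {f : Hom A B} → E f → Epi f
    M⊆Mono : ∀ {A B} {f : Hom A B} → M f → Mono f

ComonadPreservesEmbeddings : ∀ {o ℓ e p} {C : Category o ℓ e} →
  ProperFactorisationSystem C p → Comonad C → Set (o ⊔ ℓ ⊔ p)
ComonadPreservesEmbeddings {C = C} FS 𝕔 =
  ∀ {A B} (m : Category.Hom C A B) →
  ProperFactorisationSystem.M FS m → ProperFactorisationSystem.M FS (Comonad.F₁ 𝕔 m)

FunctorPreservesEmbeddings : ∀ {o ℓ e o′ ℓ′ e′ p p′} {n : ℕ}
  {Cs : Fin n → Category o ℓ e} {D : Category o′ ℓ′ e′} →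
  ((i : Fin n) → ProperFactorisationSystem (Cs i) p) →
  ProperFactorisationSystem D p′ → Functor (Π n Cs) D →
  Set (o ⊔ ℓ ⊔ p ⊔ p′)
FunctorPreservesEmbeddings {n = n} {Cs = Cs} FSs FSD H =
  ∀ {A B} (f : Category.Hom (Π n Cs) A B) →
  ((i : Fin n) → ProperFactorisationSystem.M (FSs i) (f i)) →
  ProperFactorisationSystem.M FSD (Functor.F₁ H f)

module _ {o ℓ e : Level} {C : Category o ℓ e} (𝕔 : Comonad C) where
  open Category C
  open Comonad 𝕔

  record Coalg : Set (o ⊔ ℓ ⊔ e) where
    constructor coalg
    field
      carrier : Obj
      α       : Hom carrier (F₀ carrier)
      counit  : ε carrier ∘ α ≈ id
      coass   : δ carrier ∘ α ≈ F₁ α ∘ α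

  record CoalgHom (A B : Coalg) : Set (ℓ ⊔ e) where
    constructor coalgHom
    private
      module A = Coalg A
      module B = Coalg B
    field
      hom     : Hom A.carrier B.carrier
      commute : B.α ∘ hom ≈ F₁ hom ∘ A.α

  open Coalg
  open CoalgHom

  private
    id-comm : ∀ {A : Coalg} → α A ∘ id ≈ F₁ id ∘ α A
    id-comm {A} = begin
        α A ∘ id       ≈⟨ identityʳ ⟩
        α A            ≈⟨ Eq.sym identityˡ ⟩
        id ∘ α A       ≈⟨ ∘-resp-≈ (Eq.sym identity) Eq.refl ⟩
        F₁ id ∘ α A    ∎
      where open SetoidR (hom-setoid _ _)

    comp-comm : ∀ {A B D : Coalg} (g : CoalgHom B D) (f : CoalgHom A B) →
                α D ∘ (hom g ∘ hom f) ≈ F₁ (hom g ∘ hom f) ∘ α A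
    comp-comm {A} {B} {D} g f = begin
        α D ∘ (hom g ∘ hom f)             ≈⟨ Eq.sym assoc ⟩
        (α D ∘ hom g) ∘ hom f             ≈⟨ ∘-resp-≈ (commute g) Eq.refl ⟩
        (F₁ (hom g) ∘ α B) ∘ hom f        ≈⟨ assoc ⟩
        F₁ (hom g) ∘ (α B ∘ hom f)        ≈⟨ ∘-resp-≈ Eq.refl (commute f) ⟩
        F₁ (hom g) ∘ (F₁ (hom f) ∘ α A)   ≈⟨ Eq.sym assoc ⟩
        (F₁ (hom g) ∘ F₁ (hom f)) ∘ α A   ≈⟨ ∘-resp-≈ (Eq.sym homomorphism) Eq.refl ⟩
        F₁ (hom g ∘ hom f) ∘ α A          ∎
      where open SetoidR (hom-setoid _ _)

  EM : Category (o ⊔ ℓ ⊔ e) (ℓ ⊔ e) e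
  EM = record
    { Obj       = Coalg
    ; Hom       = CoalgHom
    ; _≈_       = λ f g → hom f ≈ hom g
    ; id        = λ {A} → coalgHom id (id-comm {A})
    ; _∘_       = λ g f → coalgHom (hom g ∘ hom f) (comp-comm g f)
    ; equiv     = record { refl = Eq.refl ; sym = Eq.sym ; trans = Eq.trans }
    ; ∘-resp-≈  = ∘-resp-≈
    ; identityˡ = identityˡ
    ; identityʳ = identityʳ
    ; assoc     = assoc
    }

  cofree : Obj → Coalg
  cofree X = coalg (F₀ X) (δ X) (unitʳ X) (Eq.sym (coassoc X))

  cofree₁ : ∀ {X Y} → Hom X Y → CoalgHom (cofree X) (cofree Y)
  cofree₁ g = coalgHom (F₁ g) (δ-natural g)

  cofreeδ : ∀ X → CoalgHom (cofree X) (cofree (F₀ X))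
  cofreeδ X = coalgHom (δ X) (Eq.sym (coassoc X))

-- embeddings of EM(𝕔) for the lifted factorisation system:
-- a coalgebra morphism is an embedding iff its underlying morphism is
EMEmbedding : ∀ {o ℓ e p} {C : Category o ℓ e} →
  ProperFactorisationSystem C p → (𝕔 : Comonad C) →
  ∀ {A B} → CoalgHom 𝕔 A B → Set p
EMEmbedding FS 𝕔 f = ProperFactorisationSystem.M FS (CoalgHom.hom f)

module _ {o ℓ e : Level} (X : Category o ℓ e) where
  open Category X

  record Equaliser {A B : Obj} (f g : Hom A B) : Set (o ⊔ ℓ ⊔ e) where
    field
      obj       : Obj
      arr       : Hom obj A
      equality  : f ∘ arr ≈ g ∘ arr
      equalise  : ∀ {Z} (h : Hom Z A) → f ∘ h ≈ g ∘ h → Hom Z obj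
      universal : ∀ {Z} {h : Hom Z A} {eq : f ∘ h ≈ g ∘ h} →
                  arr ∘ equalise h eq ≈ h
      unique    : ∀ {Z} {h : Hom Z A} {eq : f ∘ h ≈ g ∘ h} {i : Hom Z obj} →
                  arr ∘ i ≈ h → i ≈ equalise h eq

  HasEqualisers : Set (o ⊔ ℓ ⊔ e)
  HasEqualisers = ∀ {A B} (f g : Hom A B) → Equaliser f g

record KleisliLaw {o ℓ e o′ ℓ′ e′ : Level} {n : ℕ}
       {Cs : Fin n → Category o ℓ e} (ℂs : (i : Fin n) → Comonad (Cs i))
       {D : Category o′ ℓ′ e′} (𝔻 : Comonad D)
       (H : Functor (Π n Cs) D)
       : Set (o ⊔ ℓ ⊔ e ⊔ o′ ⊔ ℓ′ ⊔ e′) where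
  private
    module D = Category D
    module 𝔻 = Comonad 𝔻
    module ℂ (i : Fin n) = Comonad (ℂs i)
    module H = Functor H
    ℂ₀ : Category.Obj (Π n Cs) → Category.Obj (Π n Cs)
    ℂ₀ A i = ℂ.F₀ i (A i)
  field
    κ       : (A : Category.Obj (Π n Cs)) → D.Hom (𝔻.F₀ (H.F₀ A)) (H.F₀ (ℂ₀ A))
    natural : ∀ {A B} (f : Category.Hom (Π n Cs) A B) →
              κ B D.∘ 𝔻.F₁ (H.F₁ f) D.≈ H.F₁ (λ i → ℂ.F₁ i (f i)) D.∘ κ A
    counit  : ∀ A → H.F₁ (λ i → ℂ.ε i (A i)) D.∘ κ A D.≈ 𝔻.ε (H.F₀ A)
    comult  : ∀ A → H.F₁ (λ i → ℂ.δ i (A i)) D.∘ κ A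
                    D.≈ κ (ℂ₀ A) D.∘ (𝔻.F₁ (κ A) D.∘ 𝔻.δ (H.F₀ A))

module Lift {o ℓ e o′ ℓ′ e′ : Level} {n : ℕ}
       {Cs : Fin n → Category o ℓ e} (ℂs : (i : Fin n) → Comonad (Cs i))
       {D : Category o′ ℓ′ e′} (𝔻 : Comonad D)
       (H : Functor (Π n Cs) D)
       (K : KleisliLaw ℂs 𝔻 H)
       (eqs : HasEqualisers (EM 𝔻)) where

  private
    module D = Category D
    module 𝔻 = Comonad 𝔻
    module ℂ (i : Fin n) = Comonad (ℂs i)
    module H = Functor H
    module EMD = Category (EM 𝔻)
    open KleisliLaw K
    open Coalg
    open CoalgHom

  carriers : ((i : Fin n) → Coalg (ℂs i)) → Category.Obj (Π n Cs)
  carriers αs i = carrier (αs i)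

  structure : (αs : (i : Fin n) → Coalg (ℂs i)) →
              Category.Hom (Π n Cs) (carriers αs) (λ i → ℂ.F₀ i (carriers αs i))
  structure αs i = α (αs i)

  pair₁ : (αs : (i : Fin n) → Coalg (ℂs i)) →
          EMD.Hom (cofree 𝔻 (H.F₀ (carriers αs)))
                  (cofree 𝔻 (H.F₀ (λ i → ℂ.F₀ i (carriers αs i))))
  pair₁ αs = cofree₁ 𝔻 (κ (carriers αs)) EMD.∘ cofreeδ 𝔻 (H.F₀ (carriers αs))

  pair₂ : (αs : (i : Fin n) → Coalg (ℂs i)) →
          EMD.Hom (cofree 𝔻 (H.F₀ (carriers αs)))
                  (cofree 𝔻 (H.F₀ (λ i → ℂ.F₀ i (carriers αs i))))
  pair₂ αs = cofree₁ 𝔻 (H.F₁ (structure αs))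

  equaliser : (αs : (i : Fin n) → Coalg (ℂs i)) → Equaliser (EM 𝔻) (pair₁ αs) (pair₂ αs)
  equaliser αs = eqs (pair₁ αs) (pair₂ αs)

  Ĥ₀ : ((i : Fin n) → Coalg (ℂs i)) → Coalg 𝔻
  Ĥ₀ αs = Equaliser.obj (equaliser αs)

  ι : (αs : (i : Fin n) → Coalg (ℂs i)) →
      EMD.Hom (Ĥ₀ αs) (cofree 𝔻 (H.F₀ (carriers αs)))
  ι αs = Equaliser.arr (equaliser αs)

  underlying : ∀ {αs βs : (i : Fin n) → Coalg (ℂs i)} →
               ((i : Fin n) → CoalgHom (ℂs i) (αs i) (βs i)) →
               Category.Hom (Π n Cs) (carriers αs) (carriers βs)
  underlying fs i = hom (fs i)

  equalises : ∀ {αs βs : (i : Fin n) → Coalg (ℂs i)}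
              (fs : (i : Fin n) → CoalgHom (ℂs i) (αs i) (βs i)) →
              pair₁ βs EMD.∘ (cofree₁ 𝔻 (H.F₁ (underlying fs)) EMD.∘ ι αs)
              EMD.≈ pair₂ βs EMD.∘ (cofree₁ 𝔻 (H.F₁ (underlying fs)) EMD.∘ ι αs)
  equalises {αs} {βs} fs = begin
      (Dκβ D.∘ δβ) D.∘ (DHf D.∘ i)             ≈⟨ D.assoc ⟩
      Dκβ D.∘ (δβ D.∘ (DHf D.∘ i))             ≈⟨ D.∘-resp-≈ D.Eq.refl (D.Eq.sym D.assoc) ⟩
      Dκβ D.∘ ((δβ D.∘ DHf) D.∘ i)             ≈⟨ D.∘-resp-≈ D.Eq.refl (D.∘-resp-≈ (𝔻.δ-natural (H.F₁ f)) D.Eq.refl) ⟩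
      Dκβ D.∘ ((𝔻.F₁ DHf D.∘ δα) D.∘ i)        ≈⟨ D.∘-resp-≈ D.Eq.refl D.assoc ⟩
      Dκβ D.∘ (𝔻.F₁ DHf D.∘ (δα D.∘ i))        ≈⟨ D.Eq.sym D.assoc ⟩
      (Dκβ D.∘ 𝔻.F₁ DHf) D.∘ (δα D.∘ i)        ≈⟨ D.∘-resp-≈ (D.Eq.sym 𝔻.homomorphism) D.Eq.refl ⟩
      𝔻.F₁ (κ B D.∘ DHf) D.∘ (δα D.∘ i)        ≈⟨ D.∘-resp-≈ (𝔻.F-resp-≈ (natural f)) D.Eq.refl ⟩
      𝔻.F₁ (HCf D.∘ κ A) D.∘ (δα D.∘ i)        ≈⟨ D.∘-resp-≈ 𝔻.homomorphism D.Eq.refl ⟩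
      (𝔻.F₁ HCf D.∘ Dκα) D.∘ (δα D.∘ i)        ≈⟨ D.assoc ⟩
      𝔻.F₁ HCf D.∘ (Dκα D.∘ (δα D.∘ i))        ≈⟨ D.∘-resp-≈ D.Eq.refl (D.Eq.sym D.assoc) ⟩
      𝔻.F₁ HCf D.∘ ((Dκα D.∘ δα) D.∘ i)        ≈⟨ D.∘-resp-≈ D.Eq.refl (Equaliser.equality (equaliser αs)) ⟩
      𝔻.F₁ HCf D.∘ (DHα D.∘ i)                 ≈⟨ D.Eq.sym D.assoc ⟩
      (𝔻.F₁ HCf D.∘ DHα) D.∘ i                 ≈⟨ D.∘-resp-≈ (D.Eq.sym 𝔻.homomorphism) D.Eq.refl ⟩
      𝔻.F₁ (HCf D.∘ H.F₁ (structure αs)) D.∘ i ≈⟨ D.∘-resp-≈ (𝔻.F-resp-≈ (D.Eq.sym H.homomorphism)) D.Eq.refl ⟩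
      𝔻.F₁ (H.F₁ (λ j → Category._∘_ (Cs j) (ℂ.F₁ j (f j)) (structure αs j))) D.∘ i
                                               ≈⟨ D.∘-resp-≈ (𝔻.F-resp-≈ (H.F-resp-≈ (λ j → Category.Eq.sym (Cs j) (commute (fs j))))) D.Eq.refl ⟩
      𝔻.F₁ (H.F₁ (λ j → Category._∘_ (Cs j) (structure βs j) (f j))) D.∘ i
                                               ≈⟨ D.∘-resp-≈ (𝔻.F-resp-≈ H.homomorphism) D.Eq.refl ⟩
      𝔻.F₁ (H.F₁ (structure βs) D.∘ H.F₁ f) D.∘ i ≈⟨ D.∘-resp-≈ 𝔻.homomorphism D.Eq.refl ⟩
      (DHβ D.∘ DHf) D.∘ i                      ≈⟨ D.assoc ⟩
      DHβ D.∘ (DHf D.∘ i)                      ∎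
    where
      open SetoidR (D.hom-setoid _ _)
      A = carriers αs
      B = carriers βs
      f = underlying fs
      i = hom (ι αs)
      Dκβ = 𝔻.F₁ (κ B)
      Dκα = 𝔻.F₁ (κ A)
      δβ = 𝔻.δ (H.F₀ B)
      δα = 𝔻.δ (H.F₀ A)
      DHf = 𝔻.F₁ (H.F₁ f)
      HCf = H.F₁ (λ j → ℂ.F₁ j (f j))
      DHα = 𝔻.F₁ (H.F₁ (structure αs))
      DHβ = 𝔻.F₁ (H.F₁ (structure βs))

  Ĥ₁ : ∀ {αs βs : (i : Fin n) → Coalg (ℂs i)} →
       ((i : Fin n) → CoalgHom (ℂs i) (αs i) (βs i)) →
       EMD.Hom (Ĥ₀ αs) (Ĥ₀ βs)
  Ĥ₁ {αs} {βs} fs =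
    Equaliser.equalise (equaliser βs)
      (cofree₁ 𝔻 (H.F₁ (underlying fs)) EMD.∘ ι αs) (equalises fs)

{-# OPTIONS --safe #-}
module Submission where

-- A coalgebra morphism is an embedding as soon as it has the right lifting property
-- against all quotients in EM(𝔻): since 𝔻 preserves embeddings, (E, M)-factorisations
-- lift to coalgebras, and lifting the quotient part against the morphism exhibits it as
-- a retract of the embedding part.  Now ι_β ∘ Ĥf = 𝔻(Hf) ∘ ι_α with 𝔻(Hf) an embedding;
-- a quotient e lifts against 𝔻(Hf), the filler is a coalgebra morphism and factors
-- through the equaliser ι_α because e is epi, and the filler equations for Ĥf follow
-- after composing with the monos ι_α and ι_β.

open import Defs
open import Data.Nat using (ℕ)
open import Data.Fin using (Fin)
open import Level using (Level; _⊔_)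
open import Data.Product using (_×_; _,_; ∃-syntax)
open import Function.Bundles using (Equivalence)
import Relation.Binary.Reasoning.Setoid as SetoidR

module CategoryProperties {o ℓ e : Level} (X : Category o ℓ e) where
  open Category X

  module HomReasoning {A B : Obj} = SetoidR (hom-setoid A B)

  pullʳ : ∀ {A B C D} {a : Hom C D} {b : Hom B C} {c : Hom A B} {d : Hom A C} →
          b ∘ c ≈ d → (a ∘ b) ∘ c ≈ a ∘ d
  pullʳ b∘c≈d = Eq.trans assoc (∘-resp-≈ Eq.refl b∘c≈d)

  pullˡ : ∀ {A B C D} {a : Hom C D} {b : Hom B C} {c : Hom A B} {d : Hom B D} →
          a ∘ b ≈ d → a ∘ (b ∘ c) ≈ d ∘ c
  pullˡ a∘b≈d = Eq.trans (Eq.sym assoc) (∘-resp-≈ a∘b≈d Eq.refl)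

  Equaliser-arr-mono : ∀ {A B} {f g : Hom A B} (E : Equaliser X f g) → Mono (Equaliser.arr E)
  Equaliser-arr-mono {f = f} {g} E i j arr∘i≈arr∘j =
    Eq.trans (unique arr∘i≈arr∘j) (Eq.sym (unique {eq = arr∘j-equalises} Eq.refl))
    where
      open Equaliser E
      arr∘j-equalises : f ∘ (arr ∘ j) ≈ g ∘ (arr ∘ j)
      arr∘j-equalises = Eq.trans (pullˡ equality) assoc

  ⧄-retract : ∀ {A B P Q I} {f : Hom A B} {m : Hom I Q} {h : Hom P Q}
              {q : Hom P I} {r : Hom I P} →
              r ∘ q ≈ id → m ∘ q ≈ h → h ∘ r ≈ m → f ⧄ m → f ⧄ h
  ⧄-retract {f = f} {m} {h} {q} {r} r∘q≈id m∘q≈h h∘r≈m f⧄m u v v∘f≈h∘u =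
    lift (f⧄m (q ∘ u) v square)
    where
      open HomReasoning
      square : v ∘ f ≈ m ∘ (q ∘ u)
      square = Eq.trans v∘f≈h∘u (Eq.sym (pullˡ m∘q≈h))
      lift : ∃[ d ] (d ∘ f ≈ q ∘ u × m ∘ d ≈ v) → ∃[ d ] (d ∘ f ≈ u × h ∘ d ≈ v)
      lift (d , d∘f≈q∘u , m∘d≈v) = r ∘ d , r∘d∘f≈u , h∘r∘d≈v
        where
          r∘d∘f≈u : (r ∘ d) ∘ f ≈ u
          r∘d∘f≈u = begin
            (r ∘ d) ∘ f  ≈⟨ pullʳ d∘f≈q∘u ⟩
            r ∘ (q ∘ u)  ≈⟨ pullˡ r∘q≈id ⟩
            id ∘ u       ≈⟨ identityˡ ⟩
            u            ∎
          h∘r∘d≈v : h ∘ (r ∘ d) ≈ v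
          h∘r∘d≈v = Eq.trans (pullˡ h∘r≈m) m∘d≈v

  ⧄-restriction : ∀ {A B C T} {f g : Hom A B} (E : Equaliser X f g)
                  {k : Hom T C} {m : Hom A C} {h : Hom (Equaliser.obj E) T} →
                  Mono k → k ∘ h ≈ m ∘ Equaliser.arr E →
                  ∀ {P Q} {e : Hom P Q} → Epi e → e ⧄ m → e ⧄ h
  ⧄-restriction {f = f} {g} E {k} {m} {h} k-mono k∘h≈m∘ι {e = e} e-epi e⧄m u v v∘e≈h∘u =
    lift (e⧄m (arr ∘ u) (k ∘ v) square)
    where
      open Equaliser E
      open HomReasoning
      square : (k ∘ v) ∘ e ≈ m ∘ (arr ∘ u)
      square = begin
        (k ∘ v) ∘ e    ≈⟨ pullʳ v∘e≈h∘u ⟩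
        k ∘ (h ∘ u)    ≈⟨ pullˡ k∘h≈m∘ι ⟩
        (m ∘ arr) ∘ u  ≈⟨ assoc ⟩
        m ∘ (arr ∘ u)  ∎
      lift : ∃[ d ] (d ∘ e ≈ arr ∘ u × m ∘ d ≈ k ∘ v) → ∃[ d ] (d ∘ e ≈ u × h ∘ d ≈ v)
      lift (d , d∘e≈ι∘u , m∘d≈k∘v) = d′ , d′∘e≈u , h∘d′≈v
        where
          d-equalises : f ∘ d ≈ g ∘ d
          d-equalises = e-epi (f ∘ d) (g ∘ d) (begin
            (f ∘ d) ∘ e    ≈⟨ pullʳ d∘e≈ι∘u ⟩
            f ∘ (arr ∘ u)  ≈⟨ pullˡ equality ⟩
            (g ∘ arr) ∘ u  ≈⟨ assoc ⟩
            g ∘ (arr ∘ u)  ≈˘⟨ pullʳ d∘e≈ι∘u ⟩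
            (g ∘ d) ∘ e    ∎)
          d′ : Hom _ obj
          d′ = equalise d d-equalises
          d′∘e≈u : d′ ∘ e ≈ u
          d′∘e≈u = Equaliser-arr-mono E (d′ ∘ e) u (Eq.trans (pullˡ universal) d∘e≈ι∘u)
          h∘d′≈v : h ∘ d′ ≈ v
          h∘d′≈v = k-mono (h ∘ d′) v (begin
            k ∘ (h ∘ d′)    ≈⟨ pullˡ k∘h≈m∘ι ⟩
            (m ∘ arr) ∘ d′  ≈⟨ pullʳ universal ⟩
            m ∘ d           ≈⟨ m∘d≈k∘v ⟩
            k ∘ v           ∎)

module FunctorProperties {o ℓ e o′ ℓ′ e′ : Level} {C : Category o ℓ e} {D : Category o′ ℓ′ e′}
                         (F : Functor C D) where
  private
    module C = Category C
    module D = Category D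
  open Functor F

  F-resp-square : ∀ {A B B′ Z} {a : C.Hom B Z} {b : C.Hom A B} {c : C.Hom B′ Z} {d : C.Hom A B′} →
                  a C.∘ b C.≈ c C.∘ d → F₁ a D.∘ F₁ b D.≈ F₁ c D.∘ F₁ d
  F-resp-square a∘b≈c∘d =
    D.Eq.trans (D.Eq.sym homomorphism) (D.Eq.trans (F-resp-≈ a∘b≈c∘d) homomorphism)

  F-resp-triangle : ∀ {A B Z} {a : C.Hom B Z} {b : C.Hom A B} {c : C.Hom A Z} →
                    a C.∘ b C.≈ c → F₁ a D.∘ F₁ b D.≈ F₁ c
  F-resp-triangle a∘b≈c = D.Eq.trans (D.Eq.sym homomorphism) (F-resp-≈ a∘b≈c)

module FactorisationProperties {o ℓ e p : Level} {X : Category o ℓ e}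
                               (FS : ProperFactorisationSystem X p) where
  open Category X
  open ProperFactorisationSystem FS

  E⧄M : ∀ {A B P Q} {f : Hom A B} {m : Hom P Q} → E f → M m → f ⧄ m
  E⧄M {f = f} {m} f∈E m∈M = Equivalence.to (M-is-E⧄ m) m∈M f f∈E

  M-retract : ∀ {P Q I} {m : Hom I Q} {h : Hom P Q} {q : Hom P I} {r : Hom I P} →
              r ∘ q ≈ id → m ∘ q ≈ h → h ∘ r ≈ m → M m → M h
  M-retract {h = h} r∘q≈id m∘q≈h h∘r≈m m∈M =
    Equivalence.from (M-is-E⧄ h) λ f f∈E →
      CategoryProperties.⧄-retract X r∘q≈id m∘q≈h h∘r≈m (E⧄M f∈E m∈M)

module EMProperties {o ℓ e : Level} {D : Category o ℓ e} (𝔻 : Comonad D) where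
  open Category D
  open Comonad 𝔻
  open CategoryProperties D
  open FunctorProperties F
  open Coalg
  open CoalgHom
  private
    module EM = Category (EM 𝔻)

  coalg-along-epi : (A : Coalg 𝔻) {I : Obj} (q : Hom (carrier A) I) → Epi q →
                    (c : Hom I (F₀ I)) → c ∘ q ≈ F₁ q ∘ α A → Coalg 𝔻
  coalg-along-epi A {I} q q-epi c c∘q≈Fq∘a = coalg I c c-counit c-coass
    where
      open HomReasoning
      a = α A
      c-counit : ε I ∘ c ≈ id
      c-counit = q-epi (ε I ∘ c) id (begin
        (ε I ∘ c) ∘ q     ≈⟨ pullʳ c∘q≈Fq∘a ⟩
        ε I ∘ (F₁ q ∘ a)  ≈⟨ pullˡ (ε-natural q) ⟩
        (q ∘ ε _) ∘ a     ≈⟨ pullʳ (counit A) ⟩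
        q ∘ id            ≈⟨ identityʳ ⟩
        q                 ≈˘⟨ identityˡ ⟩
        id ∘ q            ∎)
      c-coass : δ I ∘ c ≈ F₁ c ∘ c
      c-coass = q-epi (δ I ∘ c) (F₁ c ∘ c) (begin
        (δ I ∘ c) ∘ q              ≈⟨ pullʳ c∘q≈Fq∘a ⟩
        δ I ∘ (F₁ q ∘ a)           ≈⟨ pullˡ (δ-natural q) ⟩
        (F₁ (F₁ q) ∘ δ _) ∘ a      ≈⟨ pullʳ (coass A) ⟩
        F₁ (F₁ q) ∘ (F₁ a ∘ a)     ≈˘⟨ assoc ⟩
        (F₁ (F₁ q) ∘ F₁ a) ∘ a     ≈⟨ ∘-resp-≈ (F-resp-square (Eq.sym c∘q≈Fq∘a)) Eq.refl ⟩
        (F₁ c ∘ F₁ q) ∘ a          ≈⟨ pullʳ (Eq.sym c∘q≈Fq∘a) ⟩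
        F₁ c ∘ (c ∘ q)             ≈˘⟨ assoc ⟩
        (F₁ c ∘ c) ∘ q             ∎)

  commute-along-epi : ∀ {P Q Z : Coalg 𝔻} (e : CoalgHom 𝔻 P Q) → Epi (hom e) →
                      (w : CoalgHom 𝔻 P Z) {d : Hom (carrier Q) (carrier Z)} →
                      d ∘ hom e ≈ hom w → α Z ∘ d ≈ F₁ d ∘ α Q
  commute-along-epi {P} {Q} {Z} e e-epi w {d} d∘e≈w = e-epi (α Z ∘ d) (F₁ d ∘ α Q) (begin
    (α Z ∘ d) ∘ hom e          ≈⟨ pullʳ d∘e≈w ⟩
    α Z ∘ hom w                ≈⟨ commute w ⟩
    F₁ (hom w) ∘ α P           ≈˘⟨ ∘-resp-≈ (F-resp-triangle d∘e≈w) Eq.refl ⟩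
    (F₁ d ∘ F₁ (hom e)) ∘ α P  ≈⟨ pullʳ (Eq.sym (commute e)) ⟩
    F₁ d ∘ (α Q ∘ hom e)       ≈˘⟨ assoc ⟩
    (F₁ d ∘ α Q) ∘ hom e       ∎)
    where open HomReasoning

  Epi-EM : ∀ {P Q} {e : CoalgHom 𝔻 P Q} → Epi (hom e) → EM.Epi e
  Epi-EM e-epi g h = e-epi (hom g) (hom h)

  ⧄-EM : ∀ {P Q X Y} {e : CoalgHom 𝔻 P Q} {h : CoalgHom 𝔻 X Y} →
         Epi (hom e) → hom e ⧄ hom h → e EM.⧄ h
  ⧄-EM {e = e} {h} e-epi e⧄h u v v∘e≈h∘u = lift (e⧄h (hom u) (hom v) v∘e≈h∘u)
    where
      lift : ∃[ d ] (d ∘ hom e ≈ hom u × hom h ∘ d ≈ hom v) →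
             ∃[ d ] (hom d ∘ hom e ≈ hom u × hom h ∘ hom d ≈ hom v)
      lift (d , d∘e≈u , h∘d≈v) = coalgHom d (commute-along-epi e e-epi u d∘e≈u) , d∘e≈u , h∘d≈v

module EMFactorisation {o ℓ e p : Level} {D : Category o ℓ e}
                       (FS : ProperFactorisationSystem D p) (𝔻 : Comonad D)
                       (𝔻-pres : ComonadPreservesEmbeddings FS 𝔻) where
  open Category D
  open ProperFactorisationSystem FS
  open FactorisationProperties FS
  open Comonad 𝔻
  open CategoryProperties D
  open FunctorProperties F
  open EMProperties 𝔻
  open Coalg
  open CoalgHom
  private
    module EM = Category (EM 𝔻)

  record Factorisation {X Y : Coalg 𝔻} (h : CoalgHom 𝔻 X Y) : Set (o ⊔ ℓ ⊔ e ⊔ p) where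
    field
      image       : Coalg 𝔻
      quotient    : CoalgHom 𝔻 X image
      embedding   : CoalgHom 𝔻 image Y
      quotient∈E  : E (hom quotient)
      embedding∈M : M (hom embedding)
      factors     : hom embedding ∘ hom quotient ≈ hom h

  -- The coalgebra structure on the image is the diagonal filler of  q ⧄ 𝔻m,
  -- which exists because 𝔻 preserves embeddings.
  factorise-EM : ∀ {X Y} (h : CoalgHom 𝔻 X Y) → Factorisation h
  factorise-EM {X} {Y} h = from-factorisation (factorise (hom h))
    where
      from-factorisation : ∃[ I ] ∃[ q ] ∃[ m ] (E q × M m × m ∘ q ≈ hom h) → Factorisation h
      from-factorisation (I , q , m , q∈E , m∈M , m∘q≈h) =
        lift (E⧄M q∈E (𝔻-pres m m∈M) (F₁ q ∘ α X) (α Y ∘ m) square)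
        where
          open HomReasoning
          square : (α Y ∘ m) ∘ q ≈ F₁ m ∘ (F₁ q ∘ α X)
          square = begin
            (α Y ∘ m) ∘ q        ≈⟨ pullʳ m∘q≈h ⟩
            α Y ∘ hom h          ≈⟨ commute h ⟩
            F₁ (hom h) ∘ α X     ≈˘⟨ ∘-resp-≈ (F-resp-triangle m∘q≈h) Eq.refl ⟩
            (F₁ m ∘ F₁ q) ∘ α X  ≈⟨ assoc ⟩
            F₁ m ∘ (F₁ q ∘ α X)  ∎
          lift : ∃[ c ] (c ∘ q ≈ F₁ q ∘ α X × F₁ m ∘ c ≈ α Y ∘ m) → Factorisation h
          lift (c , c∘q≈Fq∘a , Fm∘c≈b∘m) = record
            { image       = coalg-along-epi X q (E⊆Epi q∈E) c c∘q≈Fq∘a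
            ; quotient    = coalgHom q c∘q≈Fq∘a
            ; embedding   = coalgHom m (Eq.sym Fm∘c≈b∘m)
            ; quotient∈E  = q∈E
            ; embedding∈M = m∈M
            ; factors     = m∘q≈h
            }

  LiftsAgainstQuotients : ∀ {X Y : Coalg 𝔻} → CoalgHom 𝔻 X Y → Set (o ⊔ ℓ ⊔ e ⊔ p)
  LiftsAgainstQuotients h = ∀ {P Q} (e : CoalgHom 𝔻 P Q) → E (hom e) → e EM.⧄ h

  -- Lifting the quotient part of h = m ∘ q against h exhibits h as a retract of m.
  liftsAgainstQuotients⇒M : ∀ {X Y} (h : CoalgHom 𝔻 X Y) → LiftsAgainstQuotients h → M (hom h)
  liftsAgainstQuotients⇒M h h-lifts =
    retract (h-lifts quotient quotient∈E EM.id embedding (Eq.trans factors (Eq.sym identityʳ)))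
    where
      open Factorisation (factorise-EM h)
      retract : ∃[ r ] (hom r ∘ hom quotient ≈ id × hom h ∘ hom r ≈ hom embedding) → M (hom h)
      retract (r , r∘q≈id , h∘r≈m) = M-retract r∘q≈id factors h∘r≈m embedding∈M

proposition6p5 : ∀ {o ℓ e o′ ℓ′ e′ p p′} (n : ℕ)
    (Cs : Fin n → Category o ℓ e)
    (FSs : (i : Fin n) → ProperFactorisationSystem (Cs i) p)
    (ℂs : (i : Fin n) → Comonad (Cs i))
    (ℂs-pres : (i : Fin n) → ComonadPreservesEmbeddings (FSs i) (ℂs i))
    (D : Category o′ ℓ′ e′)
    (FSD : ProperFactorisationSystem D p′)
    (𝔻 : Comonad D)
    (𝔻-pres : ComonadPreservesEmbeddings FSD 𝔻)
    (H : Functor (Π n Cs) D)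
    (K : KleisliLaw ℂs 𝔻 H)
    (eqs : HasEqualisers (EM 𝔻)) →
    FunctorPreservesEmbeddings FSs FSD H →
    ∀ {αs βs : (i : Fin n) → Coalg (ℂs i)}
    (fs : (i : Fin n) → CoalgHom (ℂs i) (αs i) (βs i)) →
    ((i : Fin n) → EMEmbedding (FSs i) (ℂs i) (fs i)) →
    EMEmbedding FSD 𝔻 (Lift.Ĥ₁ ℂs 𝔻 H K eqs fs)
proposition6p5 n Cs FSs ℂs _ D FSD 𝔻 𝔻-pres H K eqs H-pres {αs} {βs} fs fs∈M =
  liftsAgainstQuotients⇒M (Ĥ₁ fs) λ e e∈E →
    ⧄-restriction (equaliser αs) {k = ι βs} {m = 𝔻Hf} {h = Ĥ₁ fs}
      ι-mono ι-square {e = e}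
      (Epi-EM {e = e} (E⊆Epi e∈E))
      (⧄-EM {e = e} {h = 𝔻Hf} (E⊆Epi e∈E) (E⧄M e∈E 𝔻Hf∈M))
  where
    open Lift ℂs 𝔻 H K eqs
    open ProperFactorisationSystem FSD
    open FactorisationProperties FSD
    open CategoryProperties (EM 𝔻)
    open EMProperties 𝔻
    open EMFactorisation FSD 𝔻 𝔻-pres
    module EM = Category (EM 𝔻)
    𝔻Hf : CoalgHom 𝔻 (cofree 𝔻 (Functor.F₀ H (carriers αs))) (cofree 𝔻 (Functor.F₀ H (carriers βs)))
    𝔻Hf = cofree₁ 𝔻 (Functor.F₁ H (underlying fs))
    𝔻Hf∈M : M (CoalgHom.hom 𝔻Hf)
    𝔻Hf∈M = 𝔻-pres _ (H-pres (underlying fs) fs∈M)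
    ι-mono : EM.Mono (ι βs)
    ι-mono = Equaliser-arr-mono (equaliser βs)
    ι-square : ι βs EM.∘ Ĥ₁ fs EM.≈ 𝔻Hf EM.∘ ι αs
    ι-square = Equaliser.universal (equaliser βs)
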